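{- Let $t, r$ be integers with $1 \leq t+1 \leq r$, let $\emptyset \neq S \subseteq [t+1,r]$, let $\mathcal{H}$ be a hereditary family with $\mu(\mathcal{H}) \geq 2r-t$, let $\mathcal{F} := \bigcup_{s \in S}\mathcal{H}^{(s)}$, let $\emptyset \neq \mathcal{A} \subseteq \mathcal{F}$, and let $X$ be a $(t+1)$-transversal of $\mathcal{A}$. Then there exists some $T \in \binom{X}{t}$ such that \[|\mathcal{A}| < \frac{r-t}{\mu(\mathcal{H}) - r} \binom{|X|}{t+1} |\mathcal{F} \langle T \rangle |.\]
   Context: All sets and families are finite. For integers $m \le n$, $[m,n] := \{i \in \{1,2,\dots\} : m \le i \le n\}$. For a set $X$, $\binom{X}{t}$ is the family of $t$-subsets of $X$. A family $\mathcal{H}$ is hereditary if every subset of every member of $\mathcal{H}$ is a member of $\mathcal{H}$. A base of a family $\mathcal{F}$ is a set $B \in \mathcal{F}$ that is not a proper subset of any member of $\mathcal{F}$; $\mu(\mathcal{F})$ denotes the size of a smallest base of $\mathcal{F}$. $\mathcal{H}^{(s)} := \{H \in \mathcal{H} : |H| = s\}$. For a family $\mathcal{F}$ and a set $T$, $\mathcal{F}\langle T\rangle := \{F \in \mathcal{F} : T \subseteq F\}$. A $(t+1)$-transversal of $\mathcal{A}$ is a set $X$ with $|X \cap A| \geq t+1$ for every $A \in \mathcal{A}$. -}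

module Defs where

open import Data.Nat using (ℕ; zero; suc; _≡ᵇ_; _≤_)
open import Data.Bool using (Bool; true; false; _∧_)
open import Data.List using (List; []; _∷_; map; _++_; length; filter)
open import Data.Bool.ListAction using (any)
open import Data.Vec using (Vec; []; _∷_)
open import Data.Fin.Subset using (Subset; _⊆_; ∣_∣)
open import Data.Fin.Subset.Properties using (_⊆?_)
open import Data.Product using (Σ; _×_)
open import Relation.Binary.PropositionalEquality using (_≡_)
open import Relation.Nullary.Decidable using (does)
open import Data.Bool.Properties using (_≟_)

Family : ℕ → Set
Family n = Subset n → Bool

allSubsets : (n : ℕ) → List (Subset n)
allSubsets zero = [] ∷ []
allSubsets (suc n) = map (true ∷_) (allSubsets n) ++ map (false ∷_) (allSubsets n)

card : {n : ℕ} → Family n → ℕ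
card {n} 𝓕 = length (filter (λ B → 𝓕 B ≟ true) (allSubsets n))

Hereditary : {n : ℕ} → Family n → Set
Hereditary {n} 𝓗 = (A B : Subset n) → B ⊆ A → 𝓗 A ≡ true → 𝓗 B ≡ true

IsBase : {n : ℕ} → Family n → Subset n → Set
IsBase {n} 𝓕 B = (𝓕 B ≡ true) × ((C : Subset n) → 𝓕 C ≡ true → B ⊆ C → C ≡ B)

IsMu : {n : ℕ} → Family n → ℕ → Set
IsMu {n} 𝓕 m =
  Σ (Subset n) (λ B → IsBase 𝓕 B × ∣ B ∣ ≡ m)
  × ((B : Subset n) → IsBase 𝓕 B → m ≤ ∣ B ∣)

layers : {n : ℕ} → Family n → List ℕ → Family n
layers 𝓗 S B = 𝓗 B ∧ any (λ s → ∣ B ∣ ≡ᵇ s) S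

containing : {n : ℕ} → Family n → Subset n → Family n
containing {n} 𝓕 T B = 𝓕 B ∧ does (T ⊆? B)

module Submission where

-- The proof has three steps.
--   1. Pigeonhole: each A ∈ 𝓐 contains a (t+1)-subset of X, so for a most
--      popular one, Y, we get ∣𝓐∣ ≤ (∣X∣ choose t+1)·∣𝓐⟨Y⟩∣ ≤ (∣X∣ choose t+1)·∣𝓕⟨Y⟩∣.
--   2. Shifting: fix y ∈ Y and T = Y − y.  Exchanging y ∈ F ∈ 𝓕⟨Y⟩ for a point
--      z ∉ F of a base above F yields a member of 𝓕⟨T⟩ avoiding y.  Double
--      counting these exchanges gives (μ − r)·∣𝓕⟨Y⟩∣ ≤ (r − t)·#{G ∈ 𝓕⟨T⟩ : y ∉ G}.
--   3. 𝓕⟨T⟩ is the disjoint union of 𝓕⟨Y⟩ ≠ ∅ and {G ∈ 𝓕⟨T⟩ : y ∉ G}, and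
--      elementary arithmetic turns 1 and 2 into the strict inequality.

open import Defs
open import Data.Nat using (ℕ; zero; suc; _+_; _*_; _∸_; _≤_; _<_; z≤n; s≤s; s≤s⁻¹; _≡ᵇ_)
open import Data.Nat.Properties
open import Data.Nat.Combinatorics using (_C_; nCk+nC[k+1]≡[n+1]C[k+1])
open import Data.Bool using (Bool; true; false; _∧_; not)
open import Data.Bool.Properties using (∧-zeroʳ; ∧-assoc; T-≡) renaming (_≟_ to _≟ᵇ_)
open import Data.List using (List; []; _∷_; _++_; map; length; filter; allFin; tabulate)
open import Data.List.Properties using (map-tabulate)
open import Data.List.Membership.Propositional using () renaming (_∈_ to _∈ˡ_)
open import Data.List.Membership.Propositional.Properties using (∈-filter⁺; ∈-++⁺ˡ; ∈-++⁺ʳ; ∈-map⁺)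
open import Data.List.Relation.Unary.Any using () renaming (here to hereˡ; there to thereˡ)
import Data.List.Relation.Unary.All as All
open import Data.List.Relation.Unary.All.Properties using (all-filter)
open import Data.List.Extrema.Nat using (argmax; argmax-all; f[xs]≤f[argmax])
open import Data.Product using (Σ; _×_; _,_; proj₁; proj₂)
open import Data.Fin using (Fin; zero; suc)
open import Data.Fin.Properties using () renaming (_≟_ to _≟ᶠ_)
open import Data.Vec using (Vec; []; _∷_; lookup; _[_]≔_; here; there)
open import Data.Vec.Properties using (≡-dec; []≔-idempotent; []≔-commutes; []≔-updates; []≔-minimal; []≔-lookup; lookup∘update; lookup∘update′; []=-injective; []=⇒lookup; lookup⇒[]=)
open import Data.Fin.Subset using (Subset; inside; outside; ⊥; _∈_; _∉_; _⊆_; _∩_; ∣_∣)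
open import Data.Fin.Subset.Properties using (_⊆?_; _∈?_; ⊆-refl; ⊆-trans; p⊆q⇒∣p∣≤∣q∣; drop-∷-⊆; out⊆; in⊆in; ⊥⊆; ∣⊥∣≡0; p∩q⊆p; p∩q⊆q)
open import Function using (_∘_)
open import Level using (Level)
open import Relation.Nullary using (Dec; yes; no; does; ¬_; _×-dec_; contradiction)
open import Relation.Nullary.Decidable using (dec-true; dec-false; does-⇔)
open import Function.Bundles using (_⇔_; mk⇔; Equivalence)
open import Data.Bool.ListAction using (any)
open import Data.List.Relation.Unary.All using (All; []; _∷_)
open import Relation.Unary using (Pred; Decidable)
open import Relation.Binary.PropositionalEquality

-- Finite sums and counting over lists; counts are sums of Iverson brackets,
-- so every counting identity below reduces to the algebra of ∑.

∑ : {A : Set} → List A → (A → ℕ) → ℕ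
∑ []       f = 0
∑ (x ∷ xs) f = f x + ∑ xs f

ind : Bool → ℕ
ind true  = 1
ind false = 0

count : {A : Set} → (A → Bool) → List A → ℕ
count p xs = ∑ xs (ind ∘ p)

ind-mono : {a b : Bool} → (a ≡ true → b ≡ true) → ind a ≤ ind b
ind-mono {false} _   = z≤n
ind-mono {true}  a⇒b rewrite a⇒b refl = s≤s z≤n

module _ {A : Set} where

  ∑-cong : (xs : List A) {f g : A → ℕ} → (∀ x → f x ≡ g x) → ∑ xs f ≡ ∑ xs g
  ∑-cong []       f≗g = refl
  ∑-cong (x ∷ xs) f≗g = cong₂ _+_ (f≗g x) (∑-cong xs f≗g)

  ∑-mono : (xs : List A) {f g : A → ℕ} → (∀ x → f x ≤ g x) → ∑ xs f ≤ ∑ xs g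
  ∑-mono []       f≤g = z≤n
  ∑-mono (x ∷ xs) f≤g = +-mono-≤ (f≤g x) (∑-mono xs f≤g)

  ∑-zero : (xs : List A) → ∑ xs (λ _ → 0) ≡ 0
  ∑-zero []       = refl
  ∑-zero (x ∷ xs) = ∑-zero xs

  ∑-+ : (xs : List A) (f g : A → ℕ) → ∑ xs (λ x → f x + g x) ≡ ∑ xs f + ∑ xs g
  ∑-+ []       f g = refl
  ∑-+ (x ∷ xs) f g = begin
    f x + g x + ∑ xs (λ x → f x + g x) ≡⟨ cong (f x + g x +_) (∑-+ xs f g) ⟩
    f x + g x + (∑ xs f + ∑ xs g)      ≡⟨ interchange (f x) (g x) (∑ xs f) (∑ xs g) ⟩
    f x + ∑ xs f + (g x + ∑ xs g)      ∎
    where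
    open ≡-Reasoning
    open import Algebra.Properties.CommutativeSemigroup +-commutativeSemigroup using (interchange)

  ∑-*ˡ : (xs : List A) (k : ℕ) (f : A → ℕ) → ∑ xs (λ x → k * f x) ≡ k * ∑ xs f
  ∑-*ˡ []       k f = sym (*-zeroʳ k)
  ∑-*ˡ (x ∷ xs) k f = trans (cong (k * f x +_) (∑-*ˡ xs k f)) (sym (*-distribˡ-+ k (f x) (∑ xs f)))

  ∑-++ : (xs ys : List A) (f : A → ℕ) → ∑ (xs ++ ys) f ≡ ∑ xs f + ∑ ys f
  ∑-++ []       ys f = refl
  ∑-++ (x ∷ xs) ys f = trans (cong (f x +_) (∑-++ xs ys f)) (sym (+-assoc (f x) (∑ xs f) (∑ ys f)))

  ∑-map : {B : Set} (g : B → A) (xs : List B) (f : A → ℕ) → ∑ (map g xs) f ≡ ∑ xs (f ∘ g)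
  ∑-map g []       f = refl
  ∑-map g (x ∷ xs) f = cong (f (g x) +_) (∑-map g xs f)

  count-pos : (p : A → Bool) {x : A} (xs : List A) → x ∈ˡ xs → p x ≡ true → 1 ≤ count p xs
  count-pos p (y ∷ xs) (hereˡ refl) px rewrite px = s≤s z≤n
  count-pos p (y ∷ xs) (thereˡ x∈xs) px = ≤-trans (count-pos p xs x∈xs px) (m≤n+m _ (ind (p y)))

  count-mono : (p q : A → Bool) (xs : List A) → (∀ x → p x ≡ true → q x ≡ true) → count p xs ≤ count q xs
  count-mono p q xs p⇒q = ∑-mono xs (λ x → ind-mono (p⇒q x))

  count-split : (p q : A → Bool) (xs : List A) →
    count p xs ≡ count (λ x → p x ∧ q x) xs + count (λ x → p x ∧ not (q x)) xs
  count-split p q xs = trans (∑-cong xs (λ x → split (p x) (q x))) (∑-+ xs _ _)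
    where
    split : (a b : Bool) → ind a ≡ ind (a ∧ b) + ind (a ∧ not b)
    split true  true  = refl
    split true  false = refl
    split false b     = refl

  length-filter : (p : A → Bool) (xs : List A) → length (filter (λ x → p x ≟ᵇ true) xs) ≡ count p xs
  length-filter p []       = refl
  length-filter p (x ∷ xs) with p x
  ... | true  = cong suc (length-filter p xs)
  ... | false = length-filter p xs

∑-swap : {A B : Set} (xs : List A) (ys : List B) (f : A → B → ℕ) →
  ∑ xs (λ a → ∑ ys (f a)) ≡ ∑ ys (λ b → ∑ xs (λ a → f a b))
∑-swap []       ys f = sym (∑-zero ys)
∑-swap (x ∷ xs) ys f = begin
  ∑ ys (f x) + ∑ xs (λ a → ∑ ys (f a))             ≡⟨ cong (∑ ys (f x) +_) (∑-swap xs ys f) ⟩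
  ∑ ys (f x) + ∑ ys (λ b → ∑ xs (λ a → f a b))     ≡⟨ sym (∑-+ ys (f x) _) ⟩
  ∑ ys (λ b → f x b + ∑ xs (λ a → f a b))          ∎
  where open ≡-Reasoning

double-count : {A B : Set} (xs : List A) (ys : List B) (w : A → B → ℕ)
  (p : A → Bool) (q : B → Bool) (k m : ℕ) →
  (∀ x → p x ≡ true → k ≤ ∑ ys (w x)) →
  (∀ y → q y ≡ true → ∑ xs (λ x → w x y) ≤ m) →
  (∀ x y → q y ≡ false → w x y ≡ 0) →
  k * count p xs ≤ m * count q ys
double-count xs ys w p q k m lower upper support = begin
  k * count p xs                      ≡⟨ sym (∑-*ˡ xs k (ind ∘ p)) ⟩
  ∑ xs (λ x → k * ind (p x))          ≤⟨ ∑-mono xs lower′ ⟩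
  ∑ xs (λ x → ∑ ys (w x))             ≡⟨ ∑-swap xs ys w ⟩
  ∑ ys (λ y → ∑ xs (λ x → w x y))     ≤⟨ ∑-mono ys upper′ ⟩
  ∑ ys (λ y → m * ind (q y))          ≡⟨ ∑-*ˡ ys m (ind ∘ q) ⟩
  m * count q ys                      ∎
  where
  open ≤-Reasoning
  lower′ : ∀ x → k * ind (p x) ≤ ∑ ys (w x)
  lower′ x with p x in px
  ... | true  = ≤-trans (≤-reflexive (*-identityʳ k)) (lower x px)
  ... | false = ≤-trans (≤-reflexive (*-zeroʳ k)) z≤n
  upper′ : ∀ y → ∑ xs (λ x → w x y) ≤ m * ind (q y)
  upper′ y with q y in qy
  ... | true  = ≤-trans (upper y qy) (≤-reflexive (sym (*-identityʳ m)))
  ... | false = ≤-trans (≤-reflexive (trans (∑-cong xs (λ x → support x y qy)) (∑-zero xs))) z≤n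

maximiser : {A : Set} {ℓ : Level} {P : Pred A ℓ} → Decidable P → (f : A → ℕ) (xs : List A) {x₀ : A} → P x₀ →
  Σ A (λ m → P m × (∀ x → x ∈ˡ xs → P x → f x ≤ f m))
maximiser {P = P} P? f xs {x₀} Px₀ =
  best , argmax-all f Px₀ (all-filter P? xs) , λ x x∈xs Px → All.lookup (f[xs]≤f[argmax] x₀ candidates) (∈-filter⁺ P? x∈xs Px)
  where
  candidates = filter P? xs
  best = argmax f x₀ candidates

∧-true⁻ : {a b : Bool} → a ∧ b ≡ true → a ≡ true × b ≡ true
∧-true⁻ {true} {true} _ = refl , refl

∧-true⁺ : {a b : Bool} → a ≡ true → b ≡ true → a ∧ b ≡ true
∧-true⁺ refl refl = refl

does-true : {P : Set} (P? : Dec P) → does P? ≡ true → P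
does-true (yes p) _ = p

not-does⁻ : {P : Set} (P? : Dec P) → not (does P?) ≡ true → ¬ P
not-does⁻ (no ¬p) _ = ¬p

not-does⁺ : {P : Set} (P? : Dec P) → ¬ P → not (does P?) ≡ true
not-does⁺ P? ¬p rewrite dec-false P? ¬p = refl

_≟ˢ_ : {n : ℕ} (p q : Subset n) → Dec (p ≡ q)
_≟ˢ_ = ≡-dec _≟ᵇ_

allSubsets-complete : {n : ℕ} (p : Subset n) → p ∈ˡ allSubsets n
allSubsets-complete []                    = hereˡ refl
allSubsets-complete {suc n} (inside  ∷ p) = ∈-++⁺ˡ (∈-map⁺ (inside ∷_) (allSubsets-complete p))
allSubsets-complete {suc n} (outside ∷ p) =
  ∈-++⁺ʳ (map (inside ∷_) (allSubsets n)) (∈-map⁺ (outside ∷_) (allSubsets-complete p))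

count-allSubsets-suc : {n : ℕ} (f : Subset (suc n) → Bool) →
  count f (allSubsets (suc n)) ≡ count (f ∘ (inside ∷_)) (allSubsets n) + count (f ∘ (outside ∷_)) (allSubsets n)
count-allSubsets-suc {n} f = trans (∑-++ (map (inside ∷_) (allSubsets n)) _ _)
  (cong₂ _+_ (∑-map (inside ∷_) (allSubsets n) _) (∑-map (outside ∷_) (allSubsets n) _))

allSubsets-unique : {n : ℕ} (v : Subset n) → count (λ p → does (p ≟ˢ v)) (allSubsets n) ≡ 1
allSubsets-unique [] = refl
allSubsets-unique {suc n} (inside ∷ v) = trans (count-allSubsets-suc (λ p → does (p ≟ˢ (inside ∷ v))))
  (cong₂ _+_ (allSubsets-unique v) (∑-zero (allSubsets n)))
allSubsets-unique {suc n} (outside ∷ v) = trans (count-allSubsets-suc (λ p → does (p ≟ˢ (outside ∷ v))))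
  (cong₂ _+_ (∑-zero (allSubsets n)) (allSubsets-unique v))

count-single : {n : ℕ} (b : Bool) (v : Subset n) → count (λ p → b ∧ does (p ≟ˢ v)) (allSubsets n) ≡ ind b
count-single true  v = allSubsets-unique v
count-single {n} false v = ∑-zero (allSubsets n)

KSubset : {n : ℕ} → ℕ → Subset n → Subset n → Set
KSubset k X Y = Y ⊆ X × ∣ Y ∣ ≡ k

ksubset? : {n : ℕ} (k : ℕ) (X : Subset n) → Decidable (KSubset k X)
ksubset? k X Y = (Y ⊆? X) ×-dec (∣ Y ∣ ≟ k)

count-ksubsets : {n : ℕ} (X : Subset n) (k : ℕ) →
  count (does ∘ ksubset? k X) (allSubsets n) ≡ ∣ X ∣ C k
count-ksubsets []      zero    = refl
count-ksubsets []      (suc k) = refl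
count-ksubsets {suc n} (outside ∷ X) k = trans (count-allSubsets-suc (does ∘ ksubset? k (outside ∷ X)))
  (cong₂ _+_ (∑-zero (allSubsets n)) (count-ksubsets X k))
count-ksubsets {suc n} (inside ∷ X) zero = trans (count-allSubsets-suc (does ∘ ksubset? zero (inside ∷ X)))
  (cong₂ _+_ (trans (∑-cong (allSubsets n) (λ Y → cong ind (∧-zeroʳ (does (Y ⊆? X))))) (∑-zero (allSubsets n)))
             (count-ksubsets X zero))
count-ksubsets {suc n} (inside ∷ X) (suc k) = trans (count-allSubsets-suc (does ∘ ksubset? (suc k) (inside ∷ X)))
  (trans (cong₂ _+_ (count-ksubsets X k) (count-ksubsets X (suc k))) (nCk+nC[k+1]≡[n+1]C[k+1] ∣ X ∣ k))

∑-allFin-suc : {n : ℕ} (f : Fin (suc n) → ℕ) → ∑ (allFin (suc n)) f ≡ f zero + ∑ (allFin n) (f ∘ suc)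
∑-allFin-suc {n} f = cong (f zero +_) (begin
  ∑ (tabulate suc) f                ≡⟨ cong (λ xs → ∑ xs f) (sym (map-tabulate (λ i → i) suc)) ⟩
  ∑ (map suc (allFin n)) f          ≡⟨ ∑-map suc (allFin n) f ⟩
  ∑ (allFin n) (f ∘ suc)            ∎)
  where open ≡-Reasoning

size-difference : {n : ℕ} {p q : Subset n} → p ⊆ q →
  ∣ q ∣ ≡ ∣ p ∣ + count (λ i → does (i ∈? q) ∧ not (does (i ∈? p))) (allFin n)
size-difference {zero} {[]} {[]} p⊆q = refl
size-difference {suc n} {s ∷ p} {s′ ∷ q} p⊆q
  rewrite ∑-allFin-suc {n} (λ i → ind (does (i ∈? (s′ ∷ q)) ∧ not (does (i ∈? (s ∷ p)))))
  with s | s′ | p⊆q {zero}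
... | inside  | inside  | _   = cong suc (size-difference (drop-∷-⊆ p⊆q))
... | outside | inside  | _   = trans (cong suc (size-difference (drop-∷-⊆ p⊆q))) (sym (+-suc ∣ p ∣ _))
... | outside | outside | _   = size-difference (drop-∷-⊆ p⊆q)
... | inside  | outside | 0∈q with () ← 0∈q here

⊆-size-≡ : {n : ℕ} {p q : Subset n} → p ⊆ q → ∣ q ∣ ≤ ∣ p ∣ → q ≡ p
⊆-size-≡ {p = []} {[]} _ _ = refl
⊆-size-≡ {p = s ∷ p} {s′ ∷ q} p⊆q ∣q∣≤∣p∣ with s | s′ | p⊆q {zero}
... | inside  | inside  | _ = cong (inside ∷_) (⊆-size-≡ (drop-∷-⊆ p⊆q) (s≤s⁻¹ ∣q∣≤∣p∣))
... | outside | outside | _ = cong (outside ∷_) (⊆-size-≡ (drop-∷-⊆ p⊆q) ∣q∣≤∣p∣)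
... | outside | inside  | _ = contradiction (≤-trans ∣q∣≤∣p∣ (p⊆q⇒∣p∣≤∣q∣ (drop-∷-⊆ p⊆q))) (<-irrefl refl)
... | inside  | outside | 0∈q with () ← 0∈q here

ksubset-exists : {n : ℕ} (Z : Subset n) (k : ℕ) → k ≤ ∣ Z ∣ → Σ (Subset n) (KSubset k Z)
ksubset-exists {n} Z zero _ = ⊥ , ⊥⊆ , ∣⊥∣≡0 n
ksubset-exists (inside ∷ Z) (suc k) (s≤s k≤∣Z∣) with ksubset-exists Z k k≤∣Z∣
... | Y , Y⊆Z , ∣Y∣≡k = inside ∷ Y , in⊆in Y⊆Z , cong suc ∣Y∣≡k
ksubset-exists (outside ∷ Z) (suc k) k<∣Z∣ with ksubset-exists Z (suc k) k<∣Z∣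
... | Y , Y⊆Z , ∣Y∣≡k = outside ∷ Y , out⊆ Y⊆Z , ∣Y∣≡k

point-exists : {n : ℕ} (p : Subset n) → 1 ≤ ∣ p ∣ → Σ (Fin n) (_∈ p)
point-exists (inside ∷ p) _ = zero , here
point-exists (outside ∷ p) 1≤∣p∣ with point-exists p 1≤∣p∣
... | i , i∈p = suc i , there i∈p

update-same : {A : Set} {n : ℕ} (xs : Vec A n) (i : Fin n) {a : A} → lookup xs i ≡ a → xs [ i ]≔ a ≡ xs
update-same xs i refl = []≔-lookup xs i

update-restore : {A : Set} {n : ℕ} (xs : Vec A n) {i j : Fin n} {a b a′ b′ : A} → i ≢ j →
  lookup xs i ≡ a → lookup xs j ≡ b → (((xs [ i ]≔ a′) [ j ]≔ b′) [ j ]≔ b) [ i ]≔ a ≡ xs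
update-restore xs {i} {j} {a} {b} {a′} {b′} i≢j xsᵢ xsⱼ = begin
  (((xs [ i ]≔ a′) [ j ]≔ b′) [ j ]≔ b) [ i ]≔ a  ≡⟨ cong (_[ i ]≔ a) ([]≔-idempotent (xs [ i ]≔ a′) j) ⟩
  ((xs [ i ]≔ a′) [ j ]≔ b) [ i ]≔ a             ≡⟨ cong (_[ i ]≔ a) ([]≔-commutes xs i j i≢j) ⟩
  ((xs [ j ]≔ b) [ i ]≔ a′) [ i ]≔ a             ≡⟨ []≔-idempotent (xs [ j ]≔ b) i ⟩
  (xs [ j ]≔ b) [ i ]≔ a                         ≡⟨ cong (_[ i ]≔ a) (update-same xs j xsⱼ) ⟩
  xs [ i ]≔ a                                    ≡⟨ update-same xs i xsᵢ ⟩
  xs                                             ∎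
  where open ≡-Reasoning

∉⇒lookup : {n : ℕ} {p : Subset n} {i : Fin n} → i ∉ p → lookup p i ≡ outside
∉⇒lookup {p = p} {i} i∉p with lookup p i in e
... | inside  = contradiction (lookup⇒[]= i p e) i∉p
... | outside = refl

module _ {n : ℕ} where

  ∈-update : (p : Subset n) (i : Fin n) → i ∈ p [ i ]≔ inside
  ∈-update p i = []≔-updates p i

  ∉-update : (p : Subset n) (i : Fin n) → i ∉ p [ i ]≔ outside
  ∉-update p i i∈ with () ← []=-injective ([]≔-updates p i) i∈

  ∈-update⁺ : {p : Subset n} {i j : Fin n} {b : Bool} → j ≢ i → j ∈ p → j ∈ p [ i ]≔ b
  ∈-update⁺ {p} {i} {j} j≢i j∈p = []≔-minimal p j i j≢i j∈p

  ∈-update⁻ : {p : Subset n} {i j : Fin n} {b : Bool} → j ≢ i → j ∈ p [ i ]≔ b → j ∈ p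
  ∈-update⁻ {p} {i} {j} {b} j≢i j∈ = lookup⇒[]= j p (trans (sym (lookup∘update′ j≢i p b)) ([]=⇒lookup j∈))

  updated-value : {p : Subset n} {i : Fin n} {b : Bool} → i ∈ p [ i ]≔ b → b ≡ inside
  updated-value {p} {i} {b} i∈ = trans (sym (lookup∘update i p b)) ([]=⇒lookup i∈)

  update-⊆ : {p q : Subset n} {i : Fin n} {b : Bool} → p ⊆ q → (b ≡ inside → i ∈ q) → p [ i ]≔ b ⊆ q
  update-⊆ {i = i} p⊆q added {j} j∈ with j ≟ᶠ i
  ... | yes refl = added (updated-value j∈)
  ... | no j≢i = p⊆q (∈-update⁻ j≢i j∈)

  update-mono : {p q : Subset n} {i : Fin n} {b : Bool} → p ⊆ q → p [ i ]≔ b ⊆ q [ i ]≔ b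
  update-mono {p} {q} {i} p⊆q {j} j∈ with j ≟ᶠ i
  ... | yes refl rewrite updated-value j∈ = ∈-update q i
  ... | no j≢i = ∈-update⁺ j≢i (p⊆q (∈-update⁻ j≢i j∈))

  ⊆-update-inside : (p : Subset n) (i : Fin n) → p ⊆ p [ i ]≔ inside
  ⊆-update-inside p i {j} j∈p with j ≟ᶠ i
  ... | yes refl = ∈-update p i
  ... | no j≢i = ∈-update⁺ j≢i j∈p

∣add∣ : {n : ℕ} {p : Subset n} {i : Fin n} → i ∉ p → ∣ p [ i ]≔ inside ∣ ≡ suc ∣ p ∣
∣add∣ {p = outside ∷ p} {zero} _ = refl
∣add∣ {p = inside ∷ p} {zero} i∉p = contradiction here i∉p
∣add∣ {p = inside ∷ p} {suc i} i∉p = cong suc (∣add∣ (i∉p ∘ there))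
∣add∣ {p = outside ∷ p} {suc i} i∉p = ∣add∣ (i∉p ∘ there)

∣remove∣ : {n : ℕ} {p : Subset n} {i : Fin n} → i ∈ p → suc ∣ p [ i ]≔ outside ∣ ≡ ∣ p ∣
∣remove∣ here = refl
∣remove∣ {p = inside ∷ p} (there i∈p) = cong suc (∣remove∣ i∈p)
∣remove∣ {p = outside ∷ p} (there i∈p) = ∣remove∣ i∈p

module _ {n : ℕ} where

  card≡count : (𝓕 : Family n) → card 𝓕 ≡ count 𝓕 (allSubsets n)
  card≡count 𝓕 = length-filter 𝓕 (allSubsets n)

  card-pos : (𝓕 : Family n) {F : Subset n} → 𝓕 F ≡ true → 1 ≤ card 𝓕
  card-pos 𝓕 {F} F∈𝓕 = subst (1 ≤_) (sym (card≡count 𝓕)) (count-pos 𝓕 (allSubsets n) (allSubsets-complete F) F∈𝓕)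

  containing⁻ : (𝓕 : Family n) (T : Subset n) {F : Subset n} → containing 𝓕 T F ≡ true → 𝓕 F ≡ true × T ⊆ F
  containing⁻ 𝓕 T {F} F∈𝓕⟨T⟩ with ∧-true⁻ {𝓕 F} F∈𝓕⟨T⟩
  ... | F∈𝓕 , T⊆F = F∈𝓕 , does-true (T ⊆? F) T⊆F

  containing⁺ : (𝓕 : Family n) (T : Subset n) {F : Subset n} → 𝓕 F ≡ true → T ⊆ F → containing 𝓕 T F ≡ true
  containing⁺ 𝓕 T {F} F∈𝓕 T⊆F = ∧-true⁺ F∈𝓕 (dec-true (T ⊆? F) T⊆F)

  containing-mono : {𝓐 𝓕 : Family n} → ((A : Subset n) → 𝓐 A ≡ true → 𝓕 A ≡ true) → (Y : Subset n) →
    count (containing 𝓐 Y) (allSubsets n) ≤ count (containing 𝓕 Y) (allSubsets n)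
  containing-mono {𝓐} {𝓕} 𝓐⊆𝓕 Y = count-mono _ _ (allSubsets n) (λ A A∈𝓐⟨Y⟩ →
    let (A∈𝓐 , Y⊆A) = containing⁻ 𝓐 Y A∈𝓐⟨Y⟩ in containing⁺ 𝓕 Y (𝓐⊆𝓕 A A∈𝓐) Y⊆A)

  -- Every member of a family lies in a base: take a largest member above it.
  base-above : (𝓗 : Family n) (F : Subset n) → 𝓗 F ≡ true → Σ (Subset n) (λ B → IsBase 𝓗 B × F ⊆ B)
  base-above 𝓗 F F∈𝓗 with maximiser (λ D → (𝓗 D ≟ᵇ true) ×-dec (F ⊆? D)) ∣_∣ (allSubsets n) (F∈𝓗 , ⊆-refl)
  ... | B , (B∈𝓗 , F⊆B) , largest = B , (B∈𝓗 , maximal) , F⊆B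
    where
    maximal : (D : Subset n) → 𝓗 D ≡ true → B ⊆ D → D ≡ B
    maximal D D∈𝓗 B⊆D = ⊆-size-≡ B⊆D (largest D (allSubsets-complete D) (D∈𝓗 , ⊆-trans F⊆B B⊆D))

  record Layered (𝓗 𝓕 : Family n) (r : ℕ) : Set where
    field
      sub-𝓗   : (F : Subset n) → 𝓕 F ≡ true → 𝓗 F ≡ true
      resize  : (F G : Subset n) → 𝓕 F ≡ true → 𝓗 G ≡ true → ∣ G ∣ ≡ ∣ F ∣ → 𝓕 G ≡ true
      bounded : (F : Subset n) → 𝓕 F ≡ true → ∣ F ∣ ≤ r

  layers-layered : (𝓗 : Family n) (S : List ℕ) (r : ℕ) → All (_≤ r) S → Layered 𝓗 (layers 𝓗 S) r
  layers-layered 𝓗 S r S≤r = record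
    { sub-𝓗   = λ F F∈𝓕 → proj₁ (∧-true⁻ {𝓗 F} F∈𝓕)
    ; resize  = λ F G F∈𝓕 G∈𝓗 ∣G∣≡∣F∣ → ∧-true⁺ G∈𝓗 (subst (λ m → any (m ≡ᵇ_) S ≡ true) (sym ∣G∣≡∣F∣) (proj₂ (∧-true⁻ {𝓗 F} F∈𝓕)))
    ; bounded = λ F F∈𝓕 → size-listed S S≤r (proj₂ (∧-true⁻ {𝓗 F} F∈𝓕))
    }
    where
    size-listed : (S : List ℕ) → All (_≤ r) S → {m : ℕ} → any (m ≡ᵇ_) S ≡ true → m ≤ r
    size-listed (s ∷ S) (s≤r ∷ S≤r) {m} m∈S with m ≡ᵇ s in m≡ᵇs
    ... | true  = subst (_≤ r) (sym (≡ᵇ⇒≡ m s (Equivalence.from T-≡ m≡ᵇs))) s≤r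
    ... | false = size-listed S S≤r m∈S

-- Pigeonhole: if X is a k-transversal of 𝓐 ≠ ∅, every member of 𝓐 contains
-- a k-subset of X, so some k-subset Y of X lies in at least a 1/(∣X∣ choose k)
-- fraction of the members of 𝓐.
pigeonhole : {n : ℕ} (𝓐 : Family n) (X : Subset n) (k : ℕ) →
  ((A : Subset n) → 𝓐 A ≡ true → k ≤ ∣ X ∩ A ∣) →
  Σ (Subset n) (λ A → 𝓐 A ≡ true) →
  Σ (Subset n) (λ Y → KSubset k X Y × card 𝓐 ≤ (∣ X ∣ C k) * count (containing 𝓐 Y) (allSubsets n))
pigeonhole {n} 𝓐 X k transversal (A₀ , A₀∈𝓐) = Y , Y-ksubset , (begin
  card 𝓐                                        ≡⟨ card≡count 𝓐 ⟩
  count 𝓐 (allSubsets n)                        ≡⟨ *-identityˡ _ ⟨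
  1 * count 𝓐 (allSubsets n)                    ≤⟨ incidences-bound ⟩
  degree Y * count ksubset (allSubsets n)       ≡⟨ cong (degree Y *_) (count-ksubsets X k) ⟩
  degree Y * (∣ X ∣ C k)                        ≡⟨ *-comm (degree Y) _ ⟩
  (∣ X ∣ C k) * degree Y                        ∎)
  where
  open ≤-Reasoning
  covered : (A : Subset n) → 𝓐 A ≡ true → Σ (Subset n) (λ Z → KSubset k X Z × Z ⊆ A)
  covered A A∈𝓐 with ksubset-exists (X ∩ A) k (transversal A A∈𝓐)
  ... | Z , Z⊆X∩A , ∣Z∣≡k = Z , (⊆-trans Z⊆X∩A (p∩q⊆p X A) , ∣Z∣≡k) , ⊆-trans Z⊆X∩A (p∩q⊆q X A)
  degree : Subset n → ℕ
  degree Z = count (containing 𝓐 Z) (allSubsets n)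
  best = maximiser (ksubset? k X) degree (allSubsets n) (proj₁ (proj₂ (covered A₀ A₀∈𝓐)))
  Y = proj₁ best
  Y-ksubset = proj₁ (proj₂ best)
  largest = proj₂ (proj₂ best)
  ksubset : Subset n → Bool
  ksubset = does ∘ ksubset? k X
  incidence : Subset n → Subset n → ℕ
  incidence A Z = ind (ksubset Z ∧ containing 𝓐 Z A)
  incidences-bound : 1 * count 𝓐 (allSubsets n) ≤ degree Y * count ksubset (allSubsets n)
  incidences-bound = double-count (allSubsets n) (allSubsets n) incidence 𝓐 ksubset 1 (degree Y)
    (λ A A∈𝓐 → let (Z , Z-ksubset , Z⊆A) = covered A A∈𝓐 in
      count-pos _ (allSubsets n) (allSubsets-complete Z)
        (∧-true⁺ (dec-true (ksubset? k X Z) Z-ksubset) (containing⁺ 𝓐 Z A∈𝓐 Z⊆A)))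
    (λ Z Z-ksubset → subst (λ b → ∑ (allSubsets n) (λ A → ind (b ∧ containing 𝓐 Z A)) ≤ degree Y) (sym Z-ksubset)
      (largest Z (allSubsets-complete Z) (does-true (ksubset? k X Z) Z-ksubset)))
    (λ A Z not-ksubset → cong (λ b → ind (b ∧ containing 𝓐 Z A)) not-ksubset)

-- The shifting argument
--
-- Fix y ∈ Y and let T = Y − y.  Exchanging y for a point z turns members
-- of 𝓕⟨Y⟩ into members of 𝓕⟨T⟩ avoiding y.  Each F ∈ 𝓕⟨Y⟩ admits at least
-- μ − r such exchanges (points of a base above F), while each G arises from
-- at most r − ∣T∣ of them (z ∈ G − T determines F = G − z + y).

module Shifting {n : ℕ} (𝓗 𝓕 : Family n) (r : ℕ) (hered : Hereditary 𝓗) (layered : Layered 𝓗 𝓕 r)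
  (μ : ℕ) (μ≤base : (B : Subset n) → IsBase 𝓗 B → μ ≤ ∣ B ∣)
  (Y : Subset n) (y : Fin n) (y∈Y : y ∈ Y) where

  open Layered layered

  T : Subset n
  T = Y [ y ]≔ outside

  T⊆Y : T ⊆ Y
  T⊆Y = update-⊆ ⊆-refl (λ ())

  avoiding : Family n
  avoiding G = containing 𝓕 T G ∧ not (does (y ∈? G))

  shift unshift : Subset n → Fin n → Subset n
  shift   F z = (F [ y ]≔ outside) [ z ]≔ inside
  unshift G z = (G [ z ]≔ outside) [ y ]≔ inside

  Shifts : Subset n → Subset n → Fin n → Bool
  Shifts F G z = avoiding G ∧ containing 𝓕 Y F ∧ not (does (z ∈? F)) ∧ does (G ≟ˢ shift F z)

  shift-avoiding : {F B : Subset n} {z : Fin n} → containing 𝓕 Y F ≡ true →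
    F ⊆ B → 𝓗 B ≡ true → z ∈ B → z ∉ F → avoiding (shift F z) ≡ true
  shift-avoiding {F} {B} {z} F∈𝓕⟨Y⟩ F⊆B B∈𝓗 z∈B z∉F =
    ∧-true⁺ (containing⁺ 𝓕 T G∈𝓕 T⊆G) (not-does⁺ (y ∈? G) y∉G)
    where
    G = shift F z
    F∈𝓕 = proj₁ (containing⁻ 𝓕 Y F∈𝓕⟨Y⟩)
    Y⊆F = proj₂ (containing⁻ 𝓕 Y F∈𝓕⟨Y⟩)
    y∈F = Y⊆F y∈Y
    z≢y : z ≢ y
    z≢y refl = z∉F y∈F
    G⊆B : G ⊆ B
    G⊆B = update-⊆ (update-⊆ F⊆B (λ ())) (λ _ → z∈B)
    ∣G∣≡∣F∣ : ∣ G ∣ ≡ ∣ F ∣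
    ∣G∣≡∣F∣ = trans (∣add∣ (z∉F ∘ ∈-update⁻ z≢y)) (∣remove∣ y∈F)
    G∈𝓕 : 𝓕 G ≡ true
    G∈𝓕 = resize F G F∈𝓕 (hered B G G⊆B B∈𝓗) ∣G∣≡∣F∣
    T⊆G : T ⊆ G
    T⊆G = ⊆-trans (update-mono Y⊆F) (⊆-update-inside _ z)
    y∉G : y ∉ G
    y∉G = ∉-update F y ∘ ∈-update⁻ (z≢y ∘ sym)

  shifts⁺ : {F B : Subset n} {z : Fin n} → containing 𝓕 Y F ≡ true →
    F ⊆ B → 𝓗 B ≡ true → z ∈ B → z ∉ F → Shifts F (shift F z) z ≡ true
  shifts⁺ {F} {B} {z} F∈𝓕⟨Y⟩ F⊆B B∈𝓗 z∈B z∉F =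
    ∧-true⁺ (shift-avoiding F∈𝓕⟨Y⟩ F⊆B B∈𝓗 z∈B z∉F)
      (∧-true⁺ F∈𝓕⟨Y⟩ (∧-true⁺ (not-does⁺ (z ∈? F) z∉F) (dec-true (shift F z ≟ˢ shift F z) refl)))

  shifts⁻ : {F G : Subset n} {z : Fin n} → Shifts F G z ≡ true →
    containing 𝓕 Y F ≡ true × z ∉ F × G ≡ shift F z
  shifts⁻ {F} {G} {z} shifts with ∧-true⁻ {avoiding G} shifts
  ... | _ , rest with ∧-true⁻ {containing 𝓕 Y F} rest
  ... | F∈𝓕⟨Y⟩ , rest′ with ∧-true⁻ {not (does (z ∈? F))} rest′
  ... | z∉F , G≡shift = F∈𝓕⟨Y⟩ , not-does⁻ (z ∈? F) z∉F , does-true (G ≟ˢ shift F z) G≡shift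

  shifts-inverse : {F G : Subset n} {z : Fin n} → Shifts F G z ≡ true → (z ∈ G × z ∉ T) × F ≡ unshift G z
  shifts-inverse {F} {G} {z} shifts with shifts⁻ shifts
  ... | F∈𝓕⟨Y⟩ , z∉F , refl = (∈-update _ z , z∉F ∘ Y⊆F ∘ T⊆Y) , sym F-restored
    where
    Y⊆F = proj₂ (containing⁻ 𝓕 Y F∈𝓕⟨Y⟩)
    y∈F = Y⊆F y∈Y
    y≢z : y ≢ z
    y≢z refl = z∉F y∈F
    F-restored : unshift (shift F z) z ≡ F
    F-restored = update-restore F y≢z ([]=⇒lookup y∈F) (∉⇒lookup z∉F)

  exchanges : Subset n → Subset n → ℕ
  exchanges F G = count (Shifts F G) (allFin n)

  -- Each F ∈ 𝓕⟨Y⟩ admits at least μ − r exchanges: one for every point z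
  -- of a base B ⊇ F outside F, since ∣B∣ ≥ μ and ∣F∣ ≤ r.
  exchanges-from : (F : Subset n) → containing 𝓕 Y F ≡ true → μ ∸ r ≤ ∑ (allSubsets n) (exchanges F)
  exchanges-from F F∈𝓕⟨Y⟩ = begin
    μ ∸ r                                              ≤⟨ ∸-mono (μ≤base B B-base) (bounded F F∈𝓕) ⟩
    ∣ B ∣ ∸ ∣ F ∣                                      ≡⟨ cong (_∸ ∣ F ∣) (size-difference F⊆B) ⟩
    ∣ F ∣ + count new (allFin n) ∸ ∣ F ∣               ≡⟨ m+n∸m≡n ∣ F ∣ _ ⟩
    count new (allFin n)                               ≤⟨ ∑-mono (allFin n) shift-exists ⟩
    ∑ (allFin n) (λ z → count (λ G → Shifts F G z) (allSubsets n))
                                                       ≡⟨ ∑-swap (allSubsets n) (allFin n) _ ⟨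
    ∑ (allSubsets n) (exchanges F)                     ∎
    where
    open ≤-Reasoning
    F∈𝓕 = proj₁ (containing⁻ 𝓕 Y F∈𝓕⟨Y⟩)
    base = base-above 𝓗 F (sub-𝓗 F F∈𝓕)
    B = proj₁ base
    B-base = proj₁ (proj₂ base)
    F⊆B = proj₂ (proj₂ base)
    new : Fin n → Bool
    new z = does (z ∈? B) ∧ not (does (z ∈? F))
    shift-exists : (z : Fin n) → ind (new z) ≤ count (λ G → Shifts F G z) (allSubsets n)
    shift-exists z with new z in new-z
    ... | false = z≤n
    ... | true  = count-pos (λ G → Shifts F G z) (allSubsets n) (allSubsets-complete (shift F z))
                    (shifts⁺ F∈𝓕⟨Y⟩ F⊆B (proj₁ B-base) z∈B z∉F)
      where
      z∈B = does-true (z ∈? B) (proj₁ (∧-true⁻ new-z))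
      z∉F = not-does⁻ (z ∈? F) (proj₂ (∧-true⁻ {does (z ∈? B)} new-z))

  -- Each G avoiding y arises from at most r − ∣T∣ exchanges, one for
  -- each z ∈ G − T, because z determines F = G − z + y.
  exchanges-to : (G : Subset n) → avoiding G ≡ true → ∑ (allSubsets n) (λ F → exchanges F G) ≤ r ∸ ∣ T ∣
  exchanges-to G G-avoiding = begin
    ∑ (allSubsets n) (λ F → exchanges F G)                          ≡⟨ ∑-swap (allSubsets n) (allFin n) _ ⟩
    ∑ (allFin n) (λ z → count (λ F → Shifts F G z) (allSubsets n))  ≤⟨ ∑-mono (allFin n) at-most-one ⟩
    count new (allFin n)                                            ≡⟨ m+n∸m≡n ∣ T ∣ _ ⟨
    ∣ T ∣ + count new (allFin n) ∸ ∣ T ∣                            ≡⟨ cong (_∸ ∣ T ∣) (size-difference T⊆G) ⟨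
    ∣ G ∣ ∸ ∣ T ∣                                                   ≤⟨ ∸-monoˡ-≤ ∣ T ∣ (bounded G G∈𝓕) ⟩
    r ∸ ∣ T ∣                                                       ∎
    where
    open ≤-Reasoning
    G∈𝓕⟨T⟩ = containing⁻ 𝓕 T (proj₁ (∧-true⁻ {containing 𝓕 T G} G-avoiding))
    G∈𝓕 = proj₁ G∈𝓕⟨T⟩
    T⊆G = proj₂ G∈𝓕⟨T⟩
    new : Fin n → Bool
    new z = does (z ∈? G) ∧ not (does (z ∈? T))
    at-most-one : (z : Fin n) → count (λ F → Shifts F G z) (allSubsets n) ≤ ind (new z)
    at-most-one z = begin
      count (λ F → Shifts F G z) (allSubsets n)                       ≤⟨ count-mono _ _ (allSubsets n) undo ⟩
      count (λ F → new z ∧ does (F ≟ˢ unshift G z)) (allSubsets n)    ≡⟨ count-single (new z) (unshift G z) ⟩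
      ind (new z)                                                     ∎
      where
      undo : (F : Subset n) → Shifts F G z ≡ true → new z ∧ does (F ≟ˢ unshift G z) ≡ true
      undo F shifts with shifts-inverse shifts
      ... | (z∈G , z∉T) , F≡ = ∧-true⁺ (∧-true⁺ (dec-true (z ∈? G) z∈G) (not-does⁺ (z ∈? T) z∉T))
                                       (dec-true (F ≟ˢ unshift G z) F≡)

  shifting : (μ ∸ r) * count (containing 𝓕 Y) (allSubsets n) ≤ (r ∸ ∣ T ∣) * count avoiding (allSubsets n)
  shifting = double-count (allSubsets n) (allSubsets n) exchanges (containing 𝓕 Y) avoiding (μ ∸ r) (r ∸ ∣ T ∣)
    exchanges-from exchanges-to no-exchanges
    where
    no-exchanges : (F G : Subset n) → avoiding G ≡ false → exchanges F G ≡ 0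
    no-exchanges F G G-not-avoiding rewrite G-not-avoiding = ∑-zero (allFin n)

  split : card (containing 𝓕 T) ≡ count (containing 𝓕 Y) (allSubsets n) + count avoiding (allSubsets n)
  split = trans (card≡count (containing 𝓕 T))
    (trans (count-split (containing 𝓕 T) (λ G → does (y ∈? G)) (allSubsets n))
      (cong (_+ count avoiding (allSubsets n)) (∑-cong (allSubsets n) (cong ind ∘ containing-y))))
    where
    Y⊆⇔ : {G : Subset n} → (T ⊆ G × y ∈ G) ⇔ Y ⊆ G
    Y⊆⇔ {G} = mk⇔ add-y (λ Y⊆G → ⊆-trans T⊆Y Y⊆G , Y⊆G y∈Y)
      where
      add-y : T ⊆ G × y ∈ G → Y ⊆ G
      add-y (T⊆G , y∈G) {j} j∈Y with j ≟ᶠ y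
      ... | yes refl = y∈G
      ... | no j≢y  = T⊆G (∈-update⁺ j≢y j∈Y)
    containing-y : (G : Subset n) → containing 𝓕 T G ∧ does (y ∈? G) ≡ containing 𝓕 Y G
    containing-y G = trans (∧-assoc (𝓕 G) _ _) (cong (𝓕 G ∧_) (does-⇔ Y⊆⇔ ((T ⊆? G) ×-dec (y ∈? G)) (Y ⊆? G)))

closing-arithmetic : (A c a g k m : ℕ) → 1 ≤ A → A ≤ c * a → k * a ≤ m * g → 1 ≤ m → A * k < m * c * (a + g)
closing-arithmetic A c a g k m 1≤A A≤ca ka≤mg 1≤m = begin-strict
  A * k                       ≤⟨ *-monoˡ-≤ k A≤ca ⟩
  c * a * k                   ≡⟨ solve 3 (λ c a k → c :* a :* k := c :* (k :* a)) refl c a k ⟩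
  c * (k * a)                 ≤⟨ *-monoʳ-≤ c ka≤mg ⟩
  c * (m * g)                 <⟨ m<m+n (c * (m * g)) 0<cma ⟩
  c * (m * g) + c * (m * a)   ≡⟨ solve 4 (λ c m a g → c :* (m :* g) :+ c :* (m :* a) := m :* c :* (a :+ g)) refl c m a g ⟩
  m * c * (a + g)             ∎
  where
  open ≤-Reasoning
  open import Data.Nat.Solver using (module +-*-Solver)
  open +-*-Solver
  0<cma : 0 < c * (m * a)
  0<cma = subst (0 <_) (solve 3 (λ c m a → m :* (c :* a) := c :* (m :* a)) refl c m a)
                (*-mono-≤ 1≤m (≤-trans 1≤A A≤ca))

lemma4p5 : (n t r : ℕ) → t + 1 ≤ r
    → (S : List ℕ) → S ≢ [] → All (λ s → (t + 1 ≤ s) × (s ≤ r)) S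
    → (𝓗 : Family n) → Hereditary 𝓗
    → (μ : ℕ) → IsMu 𝓗 μ → 2 * r ∸ t ≤ μ
    → (𝓐 : Family n) → ((B : Subset n) → 𝓐 B ≡ true → layers 𝓗 S B ≡ true)
    → Σ (Subset n) (λ B → 𝓐 B ≡ true)
    → (X : Subset n) → ((B : Subset n) → 𝓐 B ≡ true → t + 1 ≤ ∣ X ∩ B ∣)
    → Σ (Subset n) (λ T → (T ⊆ X) × (∣ T ∣ ≡ t)
        × (card 𝓐 * (μ ∸ r) < (r ∸ t) * (∣ X ∣ C (t + 1)) * card (containing (layers 𝓗 S) T)))
lemma4p5 n t r t<r S _ S-bounds 𝓗 hered μ (_ , μ≤base) _ 𝓐 𝓐⊆𝓕 𝓐-nonempty X transversal =
  T , ⊆-trans T⊆Y Y⊆X , ∣T∣≡t ,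
  subst (λ N → card 𝓐 * (μ ∸ r) < (r ∸ t) * (∣ X ∣ C (t + 1)) * N) (sym split)
    (closing-arithmetic (card 𝓐) (∣ X ∣ C (t + 1)) a g (μ ∸ r) (r ∸ t) (card-pos 𝓐 (proj₂ 𝓐-nonempty))
      (≤-trans 𝓐-bound (*-monoʳ-≤ (∣ X ∣ C (t + 1)) (containing-mono 𝓐⊆𝓕 Y)))
      (subst (λ s → (μ ∸ r) * a ≤ (r ∸ s) * g) ∣T∣≡t shifting)
      (m<n⇒0<n∸m (subst (_≤ r) (+-comm t 1) t<r)))
  where
  chosen = pigeonhole 𝓐 X (t + 1) transversal 𝓐-nonempty
  Y = proj₁ chosen
  Y⊆X = proj₁ (proj₁ (proj₂ chosen))
  ∣Y∣≡t+1 = proj₂ (proj₁ (proj₂ chosen))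
  𝓐-bound = proj₂ (proj₂ chosen)
  point = point-exists Y (subst (1 ≤_) (sym ∣Y∣≡t+1) (m≤n+m 1 t))
  open Shifting 𝓗 (layers 𝓗 S) r hered (layers-layered 𝓗 S r (All.map proj₂ S-bounds))
    μ μ≤base Y (proj₁ point) (proj₂ point)
  ∣T∣≡t : ∣ T ∣ ≡ t
  ∣T∣≡t = suc-injective (trans (∣remove∣ (proj₂ point)) (trans ∣Y∣≡t+1 (+-comm t 1)))
  a g : ℕ
  a = count (containing (layers 𝓗 S) Y) (allSubsets n)
  g = count avoiding (allSubsets n)
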